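{- Let $G$ be a full-rank OSP-graph. Then for every $\sigma\in\Sigma(G)$, $\mathrm{LinExt}(\mathcal{P}(G,\sigma))\subseteq\Sigma(G)$. Consequently $\Sigma(G)=\bigcup_{\mathcal{P}\in\mathfrak{S}(G)}\mathrm{LinExt}(\mathcal{P})$, where $\mathfrak{S}(G)=\{\mathcal{P}(G,\sigma):\sigma\in\Sigma(G)\}$.
   Context: A simple pseudo-graph is a finite graph that may have loops but no multiple edges; its edge set $E(G)\subseteq V(G)\times V(G)$ is a symmetric relation, and $v$ is looped iff $vv\in E(G)$. Write $N(v)=\{w: vw\in E(G)\}$. An OSP-graph is a simple pseudo-graph whose vertex set is a finite set of positive integers with the usual order. Pressing a looped vertex $v$ produces $G_{(v)}$ with vertex set $V(G)$ and edge set $E(G)\,\triangle\,(N(v)\times N(v))$; $G_{(v_1,\dots,v_k)}$ denotes successive pressing. A successful pressing sequence is a sequence $(v_1,\dots,v_k)$ of vertices with each $v_i$ looped in $G_{(v_1,\dots,v_{i-1})}$ and $G_{(v_1,\dots,v_k)}$ having no edges and no loops; $\Sigma(G)$ is the set of these. $G$ is full-rank if its adjacency matrix (diagonal entry $1$ at looped vertices) is invertible over $\mathbb{F}_2$. For full-rank $G$ on $n$ vertices and $\sigma=(v_1,\dots,v_n)\in\Sigma(G)$, the instructional Cholesky root is the upper-triangular $0/1$ matrix $U$ with $U[i,j]=1$ iff $i\le j$ and $v_iv_j\in E(G_{(v_1,\dots,v_{i-1})})$; $D$ is the digraph on $V(G)$ with arc $v_i\to v_j$ whenever $U[i,j]=1$;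 the instructional poset $\mathcal{P}(G,\sigma)=(V(G),\preceq)$ has $y\preceq x$ iff there is a directed path (possibly of length $0$) from $x$ to $y$ in $D$. A linear extension of a poset is a listing $(\tau_1,\dots,\tau_n)$ of its elements such that $\tau_i\succ\tau_j$ implies $i<j$; $\mathrm{LinExt}(\mathcal{P})$ is the set of linear extensions. -}

module Defs where

open import Data.Nat using (ℕ; _≤_; _<_)
open import Data.Bool using (Bool; true; false; _∧_; _xor_)
open import Data.Fin using (Fin; toℕ; _≟_)
open import Relation.Nullary.Decidable using (⌊_⌋)
open import Data.List using (List; []; _∷_; length; lookup; take; foldl; foldr; allFin)
open import Data.List.Relation.Binary.Permutation.Propositional using (_↭_)
open import Data.Product using (Σ; _×_; ∃; ∃-syntax)
open import Relation.Binary.PropositionalEquality using (_≡_; _≢_)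
open import Relation.Binary.Construct.Closure.ReflexiveTransitive using (Star)

-- A simple pseudo-graph on the vertex set Fin n (an order-preserving relabelling
-- of a finite set of positive integers).  adj x y ≡ true iff xy ∈ E(G);
-- adj x x ≡ true iff x is looped.
record OSPGraph : Set where
  field
    n   : ℕ
    adj : Fin n → Fin n → Bool
    sym : ∀ x y → adj x y ≡ adj y x
open OSPGraph public

Adj : ℕ → Set
Adj n = Fin n → Fin n → Bool

-- E(G_(v)) = E(G) △ (N(v) × N(v))
press : ∀ {n} → Adj n → Fin n → Adj n
press A v x y = A x y xor (A v x ∧ A v y)

pressSeq : ∀ {n} → Adj n → List (Fin n) → Adj n
pressSeq A σ = foldl press A σ

SuccessfulPressingSeq : (G : OSPGraph) → List (Fin (n G)) → Set
SuccessfulPressingSeq G σ =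
  (∀ (i : Fin (length σ)) →
     pressSeq (adj G) (take (toℕ i) σ) (lookup σ i) (lookup σ i) ≡ true)
  × (∀ x y → pressSeq (adj G) σ x y ≡ false)

-- matrices over F₂ = Bool (xor, ∧)
mmul : ∀ {n} → Adj n → Adj n → Adj n
mmul {n} A B i j = foldr (λ k acc → (A i k ∧ B k j) xor acc) false (allFin n)

identity : ∀ {n} → Adj n
identity i j = ⌊ i ≟ j ⌋

FullRank : OSPGraph → Set
FullRank G = Σ (Adj (n G)) λ B →
  (∀ i j → mmul (adj G) B i j ≡ identity i j) ×
  (∀ i j → mmul B (adj G) i j ≡ identity i j)

-- arc v_i → v_j of the digraph D: U[i,j] = 1, i.e. i ≤ j and
-- v_i v_j ∈ E(G_(v1..v_{i-1}))
Arc : (G : OSPGraph) → List (Fin (n G)) → Fin (n G) → Fin (n G) → Set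
Arc G σ x y = ∃[ i ] ∃[ j ]
  (toℕ i ≤ toℕ j × lookup σ i ≡ x × lookup σ j ≡ y ×
   pressSeq (adj G) (take (toℕ i) σ) (lookup σ i) (lookup σ j) ≡ true)

-- instructional poset P(G,σ):  Below G σ y x means y ⪯ x,  iff there is a directed path from x to y in D
Below : (G : OSPGraph) → List (Fin (n G)) → Fin (n G) → Fin (n G) → Set
Below G σ y x = Star (Arc G σ) x y

LinExt : (G : OSPGraph) → List (Fin (n G)) → List (Fin (n G)) → Set
LinExt G σ τ =
  (τ ↭ allFin (n G)) ×
  (∀ (i j : Fin (length τ)) →
     Below G σ (lookup τ j) (lookup τ i) → lookup τ i ≢ lookup τ j → toℕ i < toℕ j)

-- A successful pressing sequence σ factors the adjacency matrix over 𝔽₂ as A = Σ_{x ∈ σ} ρₓ ρₓᵀ,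
-- where ρₓ is the row of x at the moment x is pressed (the rows of the instructional Cholesky
-- root U, so A = UᵀU).  Conversely, pressing in an order τ succeeds for such a sum as soon as
-- ρₓ x = 1 and every ρ_y vanishes at the vertices preceding y in τ: the pressed row is then
-- exactly ρₓ and pressing removes the summand ρₓ ρₓᵀ.  Since ρₓ y = 1 is an arc x → y of the
-- digraph D, every linear extension of P(G,σ) is such an order.  Full rank makes σ (and hence τ)
-- a permutation of all vertices: a vertex outside σ would yield, by back-substitution in the
-- triangular system, a nonzero vector orthogonal to all ρₓ, hence in the kernel of A.
module Submission where

open import Defs hiding (sym)
open import Algebra.Bundles using (CommutativeRing)
open import Data.Bool using (Bool; true; false; _∧_; _xor_)
open import Data.Bool.Properties
  using ( xor-∧-commutativeRing; xor-assoc; xor-same; xor-identityʳ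
        ; ∧-assoc; ∧-zeroʳ; ∧-identityʳ; ∧-comm; ∧-distribˡ-xor; ∧-distribʳ-xor; ¬-not; not-¬)
open import Data.Empty using (⊥-elim)
open import Data.Fin using (Fin; zero; suc; toℕ; _≟_; punchIn)
open import Data.Fin.Properties using (punchInᵢ≢i; toℕ-injective)
open import Data.List using (List; []; _∷_; length; lookup; take; foldr; map; allFin; tabulate)
open import Data.List.Membership.Propositional using (_∈_; _∉_)
open import Data.List.Membership.Propositional.Properties using (∈-allFin; ∈-lookup)
open import Data.List.Membership.Propositional.Properties.WithK using (unique∧set⇒bag)
import Data.List.Membership.DecPropositional as DecMembership
open import Data.List.Relation.Binary.BagAndSetEquality using (∼bag⇒↭)
open import Data.List.Relation.Binary.Permutation.Propositional using (_↭_; ↭-sym; ↭-trans; ↭⇒↭ₛ)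
open import Data.List.Relation.Binary.Permutation.Propositional.Properties using (All-resp-↭; map⁺)
open import Data.List.Relation.Binary.Permutation.Setoid.Properties
  using (foldr-commMonoid; Unique-resp-↭)
open import Data.List.Relation.Unary.All as All using (All; []; _∷_)
open import Data.List.Relation.Unary.All.Properties using (¬Any⇒All¬)
open import Data.List.Relation.Unary.AllPairs using (AllPairs; []; _∷_)
open import Data.List.Relation.Unary.Any using (here; there; index)
open import Data.List.Relation.Unary.Any.Properties using (lookup-index)
open import Data.List.Relation.Unary.Unique.Propositional using (Unique)
open import Data.List.Relation.Unary.Unique.Propositional.Properties using (allFin⁺)
open import Data.Nat using (ℕ; zero; suc; z≤n; s≤s; s<s⁻¹) renaming (_≤_ to _≤ℕ_; _<_ to _<ℕ_)
open import Data.Nat.Properties using (≤-trans; ≤-reflexive; ≤∧≢⇒<)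
open import Data.Product using (Σ; ∃; ∃-syntax; _×_; _,_; proj₁; proj₂)
open import Data.Unit using (⊤; tt)
open import Data.Vec.Functional using (Vector; updateAt)
open import Data.Vec.Functional.Properties using (updateAt-updates; updateAt-minimal)
open import Function using (_∘_; _⇔_; mk⇔; Equivalence)
open import Relation.Binary.Construct.Closure.ReflexiveTransitive using (Star; ε; _◅_)
open import Relation.Binary.PropositionalEquality
  using (_≡_; _≢_; _≗_; refl; sym; trans; cong; cong₂; cong-app; subst; setoid; module ≡-Reasoning)
open import Relation.Nullary.Decidable using (yes; no; isYes≗does; dec-true; dec-false)

open import Algebra.Properties.Semiring.Sum (CommutativeRing.semiring xor-∧-commutativeRing)
  using ( sum; sum-syntax; sum-cong-≗; sum-replicate-zero; sum-remove; ∑-comm; ∑-distrib-+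
        ; *-distribˡ-sum; *-distribʳ-sum)
open CommutativeRing xor-∧-commutativeRing using (+-isCommutativeMonoid; *-commutativeSemigroup)
open import Algebra.Properties.CommutativeSemigroup *-commutativeSemigroup using (x∙yz≈y∙xz)

xor-cancel : ∀ x y → x xor (y xor x) ≡ y
xor-cancel false y     = xor-identityʳ y
xor-cancel true  false = refl
xor-cancel true  true  = refl

identity-diagonal : ∀ {n} (x : Fin n) → identity x x ≡ true
identity-diagonal x = trans (isYes≗does (x ≟ x)) (dec-true (x ≟ x) refl)

identity-offDiagonal : ∀ {n} {x y : Fin n} → x ≢ y → identity x y ≡ false
identity-offDiagonal {x = x} {y} x≢y = trans (isYes≗does (x ≟ y)) (dec-false (x ≟ y) x≢y)

∑-false : ∀ {n} {f : Vector Bool n} → (∀ k → f k ≡ false) → sum f ≡ false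
∑-false {n} f≡false = trans (sum-cong-≗ f≡false) (sum-replicate-zero n)

∑-identity : ∀ {n} (f : Vector Bool n) x → ∑[ k < n ] (identity x k ∧ f k) ≡ f x
∑-identity {suc n} f x = begin
  sum t                          ≡⟨ sum-remove {i = x} t ⟩
  t x xor ∑[ k < n ] t (punchIn x k)
    ≡⟨ cong₂ _xor_ (cong (_∧ f x) (identity-diagonal x)) (∑-false offDiagonal) ⟩
  f x xor false                  ≡⟨ xor-identityʳ (f x) ⟩
  f x                            ∎
  where
  open ≡-Reasoning
  t : Vector Bool (suc n)
  t k = identity x k ∧ f k
  offDiagonal : ∀ k → t (punchIn x k) ≡ false
  offDiagonal k = cong (_∧ f (punchIn x k)) (identity-offDiagonal (punchInᵢ≢i x k ∘ sym))

foldr-xor-tabulate : ∀ {m n} (g : Fin n → Bool) (h : Fin m → Fin n) →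
  foldr (λ k acc → g k xor acc) false (tabulate h) ≡ ∑[ k < m ] g (h k)
foldr-xor-tabulate {zero}  g h = refl
foldr-xor-tabulate {suc m} g h = cong (g (h zero) xor_) (foldr-xor-tabulate g (h ∘ suc))

mmul-∑ : ∀ {n} (A B : Adj n) i j → mmul A B i j ≡ ∑[ k < n ] (A i k ∧ B k j)
mmul-∑ A B i j = foldr-xor-tabulate (λ k → A i k ∧ B k j) (λ k → k)

module _ {n : ℕ} where

  open DecMembership (_≟_ {n}) using (_∈?_)

  infixl 7 _·_
  infixl 6 _*ᵛ_

  _·_ : Vector Bool n → Vector Bool n → Bool
  r · y = ∑[ k < n ] (r k ∧ y k)

  _*ᵛ_ : Adj n → Vector Bool n → Vector Bool n
  (A *ᵛ y) z = A z · y

  ·-addScaledUnit : ∀ r y c v → r · (λ k → y k xor (c ∧ identity v k)) ≡ r · y xor (c ∧ r v)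
  ·-addScaledUnit r y c v = begin
    ∑[ k < n ] (r k ∧ (y k xor (c ∧ identity v k)))
      ≡⟨ sum-cong-≗ (λ k → ∧-distribˡ-xor (r k) (y k) _) ⟩
    ∑[ k < n ] ((r k ∧ y k) xor (r k ∧ (c ∧ identity v k)))
      ≡⟨ ∑-distrib-+ (λ k → r k ∧ y k) _ ⟩
    r · y xor ∑[ k < n ] (r k ∧ (c ∧ identity v k))
      ≡⟨ cong (r · y xor_) (sum-cong-≗ (λ k → x∙yz≈y∙xz (r k) c (identity v k))) ⟩
    r · y xor ∑[ k < n ] (c ∧ (r k ∧ identity v k))
      ≡⟨ cong (r · y xor_) (sym (*-distribˡ-sum c (λ k → r k ∧ identity v k))) ⟩
    r · y xor (c ∧ ∑[ k < n ] (r k ∧ identity v k))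
      ≡⟨ cong (λ s → r · y xor (c ∧ s))
              (trans (sum-cong-≗ (λ k → ∧-comm (r k) (identity v k))) (∑-identity r v)) ⟩
    r · y xor (c ∧ r v) ∎
    where open ≡-Reasoning

  LeftInverse : Adj n → Adj n → Set
  LeftInverse B A = ∀ i j → mmul B A i j ≡ identity i j

  leftInvertible⇒trivialKernel : ∀ (A B : Adj n) → LeftInverse B A →
    ∀ {y} → (∀ z → (A *ᵛ y) z ≡ false) → ∀ x → y x ≡ false
  leftInvertible⇒trivialKernel A B BA≡I {y} Ay≡0 x = begin
    y x
      ≡⟨ ∑-identity y x ⟨
    ∑[ k < n ] (identity x k ∧ y k)
      ≡⟨ sum-cong-≗ (λ k → cong (_∧ y k) (trans (sym (BA≡I x k)) (mmul-∑ B A x k))) ⟩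
    ∑[ k < n ] (∑[ l < n ] (B x l ∧ A l k) ∧ y k)
      ≡⟨ sum-cong-≗ (λ k → *-distribʳ-sum (y k) (λ l → B x l ∧ A l k)) ⟩
    ∑[ k < n ] ∑[ l < n ] ((B x l ∧ A l k) ∧ y k)
      ≡⟨ ∑-comm (λ k l → (B x l ∧ A l k) ∧ y k) ⟩
    ∑[ l < n ] ∑[ k < n ] ((B x l ∧ A l k) ∧ y k)
      ≡⟨ sum-cong-≗ (λ l → trans (sum-cong-≗ (λ k → ∧-assoc (B x l) (A l k) (y k)))
                                  (sym (*-distribˡ-sum (B x l) (λ k → A l k ∧ y k)))) ⟩
    ∑[ l < n ] (B x l ∧ (A *ᵛ y) l)
      ≡⟨ ∑-false (λ l → trans (cong (B x l ∧_) (Ay≡0 l)) (∧-zeroʳ (B x l))) ⟩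
    false ∎
    where open ≡-Reasoning

  Rows : Set
  Rows = Fin n → Vector Bool n

  gram : Rows → List (Fin n) → Adj n
  gram ρ τ a b = foldr _xor_ false (map (λ x → ρ x a ∧ ρ x b) τ)

  gram-↭ : ∀ ρ {τ τ′} → τ ↭ τ′ → ∀ a b → gram ρ τ a b ≡ gram ρ τ′ a b
  gram-↭ ρ τ↭τ′ a b =
    foldr-commMonoid (setoid Bool) +-isCommutativeMonoid (↭⇒↭ₛ (map⁺ (λ x → ρ x a ∧ ρ x b) τ↭τ′))

  gram-zeroRow : ∀ ρ {τ x} → All (λ y → ρ y x ≡ false) τ → ∀ b → gram ρ τ x b ≡ false
  gram-zeroRow ρ []             b = refl
  gram-zeroRow ρ (ρyx≡0 ∷ rest) b rewrite ρyx≡0 = gram-zeroRow ρ rest b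

  gram-annihilates : ∀ ρ {τ y} → All (λ v → ρ v · y ≡ false) τ → ∀ z → (gram ρ τ *ᵛ y) z ≡ false
  gram-annihilates ρ [] z = sum-replicate-zero n
  gram-annihilates ρ {v ∷ τ} {y} (ρv·y≡0 ∷ rest) z = begin
    ∑[ k < n ] (((ρ v z ∧ ρ v k) xor gram ρ τ z k) ∧ y k)
      ≡⟨ sum-cong-≗ (λ k → ∧-distribʳ-xor (y k) (ρ v z ∧ ρ v k) (gram ρ τ z k)) ⟩
    ∑[ k < n ] (((ρ v z ∧ ρ v k) ∧ y k) xor (gram ρ τ z k ∧ y k))
      ≡⟨ ∑-distrib-+ (λ k → (ρ v z ∧ ρ v k) ∧ y k) (λ k → gram ρ τ z k ∧ y k) ⟩
    ∑[ k < n ] ((ρ v z ∧ ρ v k) ∧ y k) xor (gram ρ τ *ᵛ y) z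
      ≡⟨ cong₂ _xor_ (trans (sum-cong-≗ (λ k → ∧-assoc (ρ v z) (ρ v k) (y k)))
                            (sym (*-distribˡ-sum (ρ v z) (λ k → ρ v k ∧ y k))))
                     (gram-annihilates ρ rest z) ⟩
    (ρ v z ∧ ρ v · y) xor false
      ≡⟨ cong (λ c → (ρ v z ∧ c) xor false) ρv·y≡0 ⟩
    (ρ v z ∧ false) xor false
      ≡⟨ cong (_xor false) (∧-zeroʳ (ρ v z)) ⟩
    false ∎
    where open ≡-Reasoning

  UpperTriangular : Rows → List (Fin n) → Set
  UpperTriangular ρ = AllPairs (λ x y → ρ y x ≡ false)

  UnitDiagonal : Rows → List (Fin n) → Set
  UnitDiagonal ρ = All (λ x → ρ x x ≡ true)

  backSubstitution : ∀ ρ {τ x} → UpperTriangular ρ τ → UnitDiagonal ρ τ → x ∉ τ →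
    ∃[ y ] y x ≡ true × All (λ v → ρ v · y ≡ false) τ
  backSubstitution ρ {[]} {x} [] [] x∉τ = identity x , identity-diagonal x , []
  backSubstitution ρ {v ∷ τ} {x} (below ∷ tri) (ρvv≡1 ∷ diag) x∉v∷τ
    with backSubstitution ρ tri diag (x∉v∷τ ∘ there)
  ... | y′ , y′x≡1 , orthogonal = y , yx≡1 , ρv·y≡0 ∷ All.zipWith ρw·y≡0 (orthogonal , below)
    where
    c : Bool
    c = ρ v · y′
    y : Vector Bool n
    y k = y′ k xor (c ∧ identity v k)
    yx≡1 : y x ≡ true
    yx≡1 rewrite identity-offDiagonal {x = v} {x} (x∉v∷τ ∘ here ∘ sym) | ∧-zeroʳ c =
      trans (xor-identityʳ (y′ x)) y′x≡1
    ρv·y≡0 : ρ v · y ≡ false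
    ρv·y≡0 rewrite ·-addScaledUnit (ρ v) y′ c v | ρvv≡1 | ∧-identityʳ c = xor-same c
    ρw·y≡0 : ∀ {w} → ρ w · y′ ≡ false × ρ w v ≡ false → ρ w · y ≡ false
    ρw·y≡0 {w} (ρw·y′≡0 , ρwv≡0) rewrite ·-addScaledUnit (ρ w) y′ c v | ρw·y′≡0 | ρwv≡0 = ∧-zeroʳ c

  leftInvertible-gram-orthogonal⇒zero : ∀ {A} B ρ {τ y} → LeftInverse B A →
    (∀ a b → A a b ≡ gram ρ τ a b) → All (λ v → ρ v · y ≡ false) τ → ∀ x → y x ≡ false
  leftInvertible-gram-orthogonal⇒zero {A} B ρ {y = y} BA≡I A≡gram orthogonal =
    leftInvertible⇒trivialKernel A B BA≡I
      (λ z → trans (sum-cong-≗ (λ k → cong (_∧ y k) (A≡gram z k))) (gram-annihilates ρ orthogonal z))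

  leftInvertible-gram⇒covers : ∀ {A} B ρ {τ} → LeftInverse B A →
    (∀ a b → A a b ≡ gram ρ τ a b) → UpperTriangular ρ τ → UnitDiagonal ρ τ → ∀ x → x ∈ τ
  leftInvertible-gram⇒covers B ρ {τ} BA≡I A≡gram tri diag x with x ∈? τ
  ... | yes x∈τ = x∈τ
  ... | no x∉τ =
    let y , yx≡1 , orthogonal = backSubstitution ρ tri diag x∉τ
    in ⊥-elim (not-¬ yx≡1 (leftInvertible-gram-orthogonal⇒zero B ρ BA≡I A≡gram orthogonal x))

  SymmetricAdj : Adj n → Set
  SymmetricAdj A = ∀ x y → A x y ≡ A y x

  press-symmetric : ∀ {A} v → SymmetricAdj A → SymmetricAdj (press A v)
  press-symmetric {A} v A-sym x y = cong₂ _xor_ (A-sym x y) (∧-comm (A v x) (A v y))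

  Successful : Adj n → List (Fin n) → Set
  Successful A []      = ∀ x y → A x y ≡ false
  Successful A (v ∷ σ) = A v v ≡ true × Successful (press A v) σ

  SuccessfulPressingSeqFor : Adj n → List (Fin n) → Set
  SuccessfulPressingSeqFor A σ =
    (∀ (i : Fin (length σ)) → pressSeq A (take (toℕ i) σ) (lookup σ i) (lookup σ i) ≡ true)
    × (∀ x y → pressSeq A σ x y ≡ false)

  successful⇔ : ∀ A σ → SuccessfulPressingSeqFor A σ ⇔ Successful A σ
  successful⇔ A σ = mk⇔ (to A σ) (from A σ)
    where
    to : ∀ A σ → SuccessfulPressingSeqFor A σ → Successful A σ
    to A []      (_ , empty)     = empty
    to A (v ∷ σ) (looped , empty) = looped zero , to (press A v) σ (looped ∘ suc , empty)
    from : ∀ A σ → Successful A σ → SuccessfulPressingSeqFor A σ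
    from A []      empty           = (λ ()) , empty
    from A (v ∷ σ) (looped , rest) with from (press A v) σ rest
    ... | looped′ , empty = (λ { zero → looped ; (suc i) → looped′ i }) , empty

  gram-successful : ∀ ρ {C τ} → UpperTriangular ρ τ → UnitDiagonal ρ τ →
    (∀ a b → C a b ≡ gram ρ τ a b) → Successful C τ
  gram-successful ρ {τ = []}    []            []             C≡gram = C≡gram
  gram-successful ρ {C} {x ∷ τ} (below ∷ tri) (ρxx≡1 ∷ diag) C≡gram =
    trans (pivotRow x) ρxx≡1 , gram-successful ρ tri diag pressed≡gram
    where
    pivotRow : ∀ w → C x w ≡ ρ x w
    pivotRow w rewrite C≡gram x w | ρxx≡1 | gram-zeroRow ρ below w = xor-identityʳ (ρ x w)
    pressed≡gram : ∀ a b → press C x a b ≡ gram ρ τ a b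
    pressed≡gram a b rewrite C≡gram a b | pivotRow a | pivotRow b =
      trans (xor-assoc (ρ x a ∧ ρ x b) _ _) (xor-cancel (ρ x a ∧ ρ x b) (gram ρ τ a b))

  Isolated : Adj n → Fin n → Set
  Isolated C v = ∀ k → C v k ≡ false

  press-isolates : ∀ {C v} → C v v ≡ true → Isolated (press C v) v
  press-isolates {C} {v} Cvv≡1 k rewrite Cvv≡1 = xor-same (C v k)

  press-preservesIsolated : ∀ {C v} w → SymmetricAdj C → Isolated C v → Isolated (press C w) v
  press-preservesIsolated {C} {v} w C-sym v-isolated k
    rewrite v-isolated k | C-sym w v | v-isolated w = refl

  isolated-neverPressed : ∀ {C v} σ → SymmetricAdj C → Isolated C v → Successful C σ → v ∉ σ
  isolated-neverPressed (w ∷ σ) _ v-isolated (looped , _) (here refl)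
    with trans (sym looped) (v-isolated w)
  ... | ()
  isolated-neverPressed (w ∷ σ) C-sym v-isolated (looped , rest) (there v∈σ) =
    isolated-neverPressed σ (press-symmetric w C-sym)
      (press-preservesIsolated w C-sym v-isolated) rest v∈σ

  successful⇒unique : ∀ {A} σ → SymmetricAdj A → Successful A σ → Unique σ
  successful⇒unique []      _ _ = []
  successful⇒unique {A} (v ∷ σ) A-sym (looped , rest) =
    ¬Any⇒All¬ σ
      (isolated-neverPressed σ (press-symmetric v A-sym) (press-isolates {A} looped) rest)
    ∷ successful⇒unique σ (press-symmetric v A-sym) rest

  CholeskyRows : Adj n → List (Fin n) → Rows → Set
  CholeskyRows A []      ρ = ⊤
  CholeskyRows A (v ∷ σ) ρ = ρ v ≗ A v × CholeskyRows (press A v) σ ρ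

  choleskyRows-cong : ∀ {A} σ {ρ ρ′} → CholeskyRows A σ ρ → All (λ x → ρ x ≗ ρ′ x) σ →
    CholeskyRows A σ ρ′
  choleskyRows-cong []      tt              []              = tt
  choleskyRows-cong (v ∷ σ) (ρv≗Av , rows) (ρv≗ρ′v ∷ same) =
    (λ k → trans (sym (ρv≗ρ′v k)) (ρv≗Av k)) , choleskyRows-cong σ rows same

  choleskyRows-exist : ∀ A {σ} → Unique σ → ∃ (CholeskyRows A σ)
  choleskyRows-exist A {[]}    []            = (λ _ _ → false) , tt
  choleskyRows-exist A {v ∷ σ} (v∉σ ∷ uniq) with choleskyRows-exist (press A v) uniq
  ... | ρ′ , rows′ = ρ , cong-app (updateAt-updates v ρ′) , choleskyRows-cong σ rows′ agree
    where
    ρ : Rows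
    ρ = updateAt ρ′ v (λ _ → A v)
    agree : All (λ x → ρ′ x ≗ ρ x) σ
    agree = All.map (λ v≢x → cong-app (sym (updateAt-minimal _ v ρ′ (v≢x ∘ sym)))) v∉σ

  cholesky-gram : ∀ {A} σ {ρ} → Successful A σ → CholeskyRows A σ ρ → ∀ a b → A a b ≡ gram ρ σ a b
  cholesky-gram []          empty      tt              a b = empty a b
  cholesky-gram {A} (v ∷ σ) {ρ} (_ , rest) (ρv≗Av , rows) a b = begin
    A a b                                  ≡⟨ xor-cancel (A v a ∧ A v b) (A a b) ⟨
    (A v a ∧ A v b) xor press A v a b      ≡⟨ cong₂ _xor_ (sym (cong₂ _∧_ (ρv≗Av a) (ρv≗Av b)))
                                                          (cholesky-gram σ rest rows a b) ⟩
    (ρ v a ∧ ρ v b) xor gram ρ σ a b       ∎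
    where open ≡-Reasoning

  cholesky-unitDiagonal : ∀ {A} σ {ρ} → Successful A σ → CholeskyRows A σ ρ → UnitDiagonal ρ σ
  cholesky-unitDiagonal []      _               tt              = []
  cholesky-unitDiagonal (v ∷ σ) (looped , rest) (ρv≗Av , rows) =
    trans (ρv≗Av v) looped ∷ cholesky-unitDiagonal σ rest rows

  cholesky-vanishesAtIsolated : ∀ {C v} σ {ρ} → SymmetricAdj C → Isolated C v → CholeskyRows C σ ρ →
    All (λ y → ρ y v ≡ false) σ
  cholesky-vanishesAtIsolated []      _ _ tt = []
  cholesky-vanishesAtIsolated {C} {v} (w ∷ σ) C-sym v-isolated (ρw≗Cw , rows) =
    trans (ρw≗Cw v) (trans (C-sym w v) (v-isolated w))
    ∷ cholesky-vanishesAtIsolated σ (press-symmetric w C-sym)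
        (press-preservesIsolated w C-sym v-isolated) rows

  cholesky-upperTriangular : ∀ {A} σ {ρ} → SymmetricAdj A → Successful A σ → CholeskyRows A σ ρ →
    UpperTriangular ρ σ
  cholesky-upperTriangular []      _ _ tt = []
  cholesky-upperTriangular {A} (v ∷ σ) A-sym (looped , rest) (_ , rows) =
    cholesky-vanishesAtIsolated σ (press-symmetric v A-sym) (press-isolates {A} looped) rows
    ∷ cholesky-upperTriangular σ (press-symmetric v A-sym) rest rows

  PressArc : Adj n → List (Fin n) → Fin n → Fin n → Set
  PressArc A σ x y = ∃[ i ] ∃[ j ]
    (toℕ i ≤ℕ toℕ j × lookup σ i ≡ x × lookup σ j ≡ y ×
     pressSeq A (take (toℕ i) σ) (lookup σ i) (lookup σ j) ≡ true)

  cholesky-arc : ∀ {A} σ {ρ x y} → SymmetricAdj A → Successful A σ → CholeskyRows A σ ρ →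
    x ∈ σ → y ∈ σ → ρ x y ≡ true → PressArc A σ x y
  cholesky-arc {A} (v ∷ σ) {y = y} _ _ (ρv≗Av , _) (here refl) y∈ ρvy≡1 =
    zero , index y∈ , z≤n , refl , sym (lookup-index y∈) ,
    subst (λ w → A v w ≡ true) (lookup-index y∈) (trans (sym (ρv≗Av y)) ρvy≡1)
  cholesky-arc {A} (v ∷ σ) A-sym (looped , rest) (_ , rows) (there x∈σ) (here refl) ρxv≡1
    with trans (sym ρxv≡1) (All.lookup (cholesky-vanishesAtIsolated σ (press-symmetric v A-sym)
                                           (press-isolates {A} looped) rows) x∈σ)
  ... | ()
  cholesky-arc (v ∷ σ) A-sym (looped , rest) (_ , rows) (there x∈σ) (there y∈σ) ρxy≡1
    with cholesky-arc σ (press-symmetric v A-sym) rest rows x∈σ y∈σ ρxy≡1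
  ... | i , j , i≤j , σi≡x , σj≡y , arc = suc i , suc j , s≤s i≤j , σi≡x , σj≡y , arc

  RespectsOrder : (Fin n → Fin n → Set) → List (Fin n) → Set
  RespectsOrder _≼_ τ = ∀ (i j : Fin (length τ)) →
    lookup τ j ≼ lookup τ i → lookup τ i ≢ lookup τ j → toℕ i <ℕ toℕ j

  respectsOrder⇒upperTriangular : ∀ {_≼_ : Fin n → Fin n → Set} ρ {τ} →
    (∀ {x y} → ρ x y ≡ true → y ≼ x) → Unique τ → RespectsOrder _≼_ τ → UpperTriangular ρ τ
  respectsOrder⇒upperTriangular ρ {[]} _ [] _ = []
  respectsOrder⇒upperTriangular {_≼_} ρ {x ∷ τ} arcs (x∉τ ∷ uniq) ordered =
    All.tabulate (λ y∈τ → ¬-not (laterRowMissesPivot y∈τ))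
    ∷ respectsOrder⇒upperTriangular ρ arcs uniq
        (λ i j y≼x x≢y → s<s⁻¹ (ordered (suc i) (suc j) y≼x x≢y))
    where
    laterRowMissesPivot : ∀ {y} → y ∈ τ → ρ y x ≢ true
    laterRowMissesPivot y∈τ ρyx≡1 with
      ordered (suc (index y∈τ)) zero (subst (x ≼_) (lookup-index y∈τ) (arcs ρyx≡1))
              (λ y≡x → All.lookup x∉τ y∈τ (sym (trans (lookup-index y∈τ) y≡x)))
    ... | ()

  lookup-injective : ∀ {τ : List (Fin n)} → Unique τ → ∀ i j → lookup τ i ≡ lookup τ j → i ≡ j
  lookup-injective (_ ∷ _)     zero    zero    _      = refl
  lookup-injective (x∉τ ∷ uniq) zero    (suc j) x≡τj   = ⊥-elim (All.lookup x∉τ (∈-lookup j) x≡τj)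
  lookup-injective (x∉τ ∷ uniq) (suc i) zero    τi≡x   = ⊥-elim (All.lookup x∉τ (∈-lookup i) (sym τi≡x))
  lookup-injective (x∉τ ∷ uniq) (suc i) (suc j) τi≡τj = cong suc (lookup-injective uniq i j τi≡τj)

  pressPath-forward : ∀ {A τ} → Unique τ → ∀ {a b} → Star (PressArc A τ) a b →
    ∀ i j → lookup τ i ≡ a → lookup τ j ≡ b → toℕ i ≤ℕ toℕ j
  pressPath-forward uniq ε i j τi≡a τj≡a =
    ≤-reflexive (cong toℕ (lookup-injective uniq i j (trans τi≡a (sym τj≡a))))
  pressPath-forward uniq ((i′ , j′ , i′≤j′ , τi′≡a , τj′≡c , _) ◅ path) i j τi≡a τj≡b =
    ≤-trans (≤-reflexive (cong toℕ (lookup-injective uniq i i′ (trans τi≡a (sym τi′≡a)))))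
      (≤-trans i′≤j′ (pressPath-forward uniq path j′ j τj′≡c τj≡b))

  unique-covering⇒↭allFin : ∀ {σ} → Unique σ → (∀ x → x ∈ σ) → σ ↭ allFin n
  unique-covering⇒↭allFin uniq covers =
    ∼bag⇒↭ (unique∧set⇒bag uniq (allFin⁺ n) (mk⇔ (λ _ → ∈-allFin _) (λ _ → covers _)))

  leftInvertible-successful⇒covers : ∀ {A} B {σ} → LeftInverse B A →
    SymmetricAdj A → Successful A σ → ∀ x → x ∈ σ
  leftInvertible-successful⇒covers {A} B {σ} BA≡I A-sym succ
    with choleskyRows-exist A (successful⇒unique σ A-sym succ)
  ... | ρ , rows = leftInvertible-gram⇒covers B ρ BA≡I (cholesky-gram σ succ rows)
                     (cholesky-upperTriangular σ A-sym succ rows) (cholesky-unitDiagonal σ succ rows)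

linExt⇒successful : (G : OSPGraph) → FullRank G → (σ τ : List (Fin (n G))) →
  SuccessfulPressingSeq G σ → LinExt G σ τ → SuccessfulPressingSeq G τ
linExt⇒successful G (B , _ , BA≡I) σ τ σ-succ (τ↭allFin , τ-ordered) =
  Equivalence.from (successful⇔ A τ)
    (gram-successful ρ triangular (All-resp-↭ σ↭τ (cholesky-unitDiagonal σ succ rows))
      (λ a b → trans (cholesky-gram σ succ rows a b) (gram-↭ ρ σ↭τ a b)))
  where
  A = adj G
  succ = Equivalence.to (successful⇔ A σ) σ-succ
  uniq = successful⇒unique σ (OSPGraph.sym G) succ
  ρ = proj₁ (choleskyRows-exist A uniq)
  rows = proj₂ (choleskyRows-exist A uniq)
  covers = leftInvertible-successful⇒covers B BA≡I (OSPGraph.sym G) succ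
  σ↭τ = ↭-trans (unique-covering⇒↭allFin uniq covers) (↭-sym τ↭allFin)
  triangular : UpperTriangular ρ τ
  triangular = respectsOrder⇒upperTriangular ρ
    (λ ρxy≡1 → cholesky-arc σ (OSPGraph.sym G) succ rows (covers _) (covers _) ρxy≡1 ◅ ε)
    (Unique-resp-↭ (setoid (Fin (n G))) (↭⇒↭ₛ (↭-sym τ↭allFin)) (allFin⁺ (n G))) τ-ordered

successful⇒selfLinExt : (G : OSPGraph) → FullRank G → (τ : List (Fin (n G))) →
  SuccessfulPressingSeq G τ → LinExt G τ τ
successful⇒selfLinExt G (B , _ , BA≡I) τ τ-succ =
  unique-covering⇒↭allFin uniq (leftInvertible-successful⇒covers B BA≡I (OSPGraph.sym G) succ) ,
  λ i j path τi≢τj →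
    ≤∧≢⇒< (pressPath-forward uniq path i j refl refl) (τi≢τj ∘ cong (lookup τ) ∘ toℕ-injective)
  where
  succ = Equivalence.to (successful⇔ (adj G) τ) τ-succ
  uniq = successful⇒unique τ (OSPGraph.sym G) succ

mainTheorem2 : (G : OSPGraph) → FullRank G →
    ((σ τ : List (Fin (n G))) → SuccessfulPressingSeq G σ → LinExt G σ τ →
       SuccessfulPressingSeq G τ)
    × ((τ : List (Fin (n G))) →
       SuccessfulPressingSeq G τ ⇔
         Σ (List (Fin (n G))) (λ σ → SuccessfulPressingSeq G σ × LinExt G σ τ))
mainTheorem2 G fullRank =
  linExt⇒successful G fullRank ,
  λ τ → mk⇔ (λ τ-succ → τ , τ-succ , successful⇒selfLinExt G fullRank τ τ-succ)
            (λ (σ , σ-succ , τ-linExt) → linExt⇒successful G fullRank σ τ σ-succ τ-linExt)
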